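{- Let $\mathbb F$ be a field with $|\mathbb F|>k$, let $n>k\ge 1$ with $n+k$ odd, and let $T$ be a linear map on $\mathrm{M}_{n\,k}(\mathbb F)$ such that $\det_{n\,k}(T(X))=\det_{n\,k}(X)$ for all $X\in\mathrm{M}_{n\,k}(\mathbb F)$. Define the linear map $S = L^{ - }\circ T\circ L^{+}$ on $\mathrm{M}_{(n-1)\,k}(\mathbb F)$. Then $\det_{(n-1)\,k}(S(Y)) = \det_{(n-1)\,k}(Y)$ for all $Y\in\mathrm{M}_{(n-1)\,k}(\mathbb F)$.
   Context: $|\mathbb F|>k$ means $\mathbb F$ is infinite or finite with more than $k$ elements. For $m \ge k$ and $X=(x_{i\,j})\in\mathrm{M}_{m\,k}(\mathbb F)$, the Cullis determinant is $\det_{m\,k}(X) = \sum_{\sigma} \operatorname{sgn}_{m\,k}(\sigma)\, x_{\sigma(1)\,1}\cdots x_{\sigma(k)\,k}$, the sum over all injections $\sigma\colon\{1,\ldots,k\}\to\{1,\ldots,m\}$, where, writing $\sigma(\{1,\dots,k\})=\{i_1<\cdots<i_k\}$, $\operatorname{sgn}_{m\,k}(\sigma)=\operatorname{sgn}(\pi_\sigma)(-1)^{\sum_{\alpha=1}^k(i_\alpha-\alpha)}$ with $\pi_\sigma$ the permutation of $\{i_1,\dots,i_k\}$ sending $i_\alpha\mapsto\sigma(\alpha)$. For $X\in\mathrm{M}_{n\,k}(\mathbb F)$, $L^{ - }(X)\in\mathrm{M}_{(n-1)\,k}(\mathbb F)$ has $r$-th row equal to (row $r$ of $X$) minus (row $n$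 of $X$), $1\le r\le n-1$. For $Y\in\mathrm{M}_{(n-1)\,k}(\mathbb F)$, $L^{+}(Y)\in\mathrm{M}_{n\,k}(\mathbb F)$ is $Y$ with a zero row adjoined as the last row. -}

module Defs where

open import Level using (Level; _⊔_)
open import Data.Nat as ℕ using (ℕ; zero; suc; _∸_)
open import Data.Fin as Fin using (Fin; toℕ; fromℕ; inject₁)
open import Data.Fin.Properties using () renaming (_≟_ to _≟ᶠ_)
open import Data.List using (List; []; _∷_; map; concatMap; foldr; filter; allFin)
open import Data.Bool using (Bool; true; false; _∧_; _∨_; not; T?)
open import Data.Product using (∃)
open import Relation.Nullary using (¬_; Dec; yes; no)
open import Relation.Nullary.Decidable using (⌊_⌋)
open import Relation.Binary.PropositionalEquality using (_≡_; _≢_)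
open import Algebra.Bundles using (CommutativeRing)
import Data.Vec.Functional as VF

record Field c ℓ : Set (Level.suc (c ⊔ ℓ)) where
  field
    commutativeRing : CommutativeRing c ℓ
  open CommutativeRing commutativeRing public
  field
    1≉0     : ¬ (1# ≈ 0#)
    inverse : ∀ x → ¬ (x ≈ 0#) → ∃ λ y → (x * y) ≈ 1#

module _ {c ℓ} (F : Field c ℓ) where
  open Field F

  CardGreaterThan : ℕ → Set (c ⊔ ℓ)
  CardGreaterThan k =
    ∃ λ (f : Fin (suc k) → Carrier) → ∀ i j → i ≢ j → ¬ (f i ≈ f j)

  -- m × k matrices over F, X i j = entry in row i, column j
  Mat : ℕ → ℕ → Set c
  Mat m k = Fin m → Fin k → Carrier

  _≈ᴹ_ : ∀ {m k} → Mat m k → Mat m k → Set ℓ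
  X ≈ᴹ Y = ∀ i j → X i j ≈ Y i j
  infix 4 _≈ᴹ_

  _+ᴹ_ : ∀ {m k} → Mat m k → Mat m k → Mat m k
  (X +ᴹ Y) i j = X i j + Y i j

  _·ᴹ_ : ∀ {m k} → Carrier → Mat m k → Mat m k
  (a ·ᴹ X) i j = a * X i j

  record IsLinear {m k : ℕ} (T : Mat m k → Mat m k) : Set (c ⊔ ℓ) where
    field
      cong     : ∀ {X Y} → X ≈ᴹ Y → T X ≈ᴹ T Y
      additive : ∀ X Y → T (X +ᴹ Y) ≈ᴹ (T X +ᴹ T Y)
      homogen  : ∀ a X → T (a ·ᴹ X) ≈ᴹ (a ·ᴹ T X)

  allMaps : (k m : ℕ) → List (Fin k → Fin m)
  allMaps zero    m = (λ ()) ∷ []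
  allMaps (suc k) m =
    concatMap (λ i → map (λ f → i VF.∷ f) (allMaps k m)) (allFin m)

  sumℕ : ∀ {k} → (Fin k → ℕ) → ℕ
  sumℕ {k} f = foldr (λ a s → f a ℕ.+ s) 0 (allFin k)

  isInjective : ∀ {k m} → (Fin k → Fin m) → Bool
  isInjective {k} σ =
    foldr _∧_ true
      (concatMap (λ α → map (λ β → ⌊ α ≟ᶠ β ⌋ ∨ not ⌊ σ α ≟ᶠ σ β ⌋)
                            (allFin k))
                 (allFin k))

  injections : (k m : ℕ) → List (Fin k → Fin m)
  injections k m = filter (λ σ → T? (isInjective σ)) (allMaps k m)

  -- number of inversions of σ: pairs α < β with σ α > σ β;
  -- sgn(π_σ) = (-1)^(inversions of σ)
  inversions : ∀ {k m} → (Fin k → Fin m) → ℕ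
  inversions {k} σ =
    foldr ℕ._+_ 0
      (concatMap (λ α → map (λ β → if⟨ (toℕ α ℕ.<ᵇ toℕ β) ∧ (toℕ (σ β) ℕ.<ᵇ toℕ (σ α)) ⟩)
                            (allFin k))
                 (allFin k))
    where
      if⟨_⟩ : Bool → ℕ
      if⟨ true ⟩  = 1
      if⟨ false ⟩ = 0

  negOnePow : ℕ → Carrier
  negOnePow zero    = 1#
  negOnePow (suc e) = - negOnePow e

  -- sgn_{m k}(σ) = sgn(π_σ) · (-1)^{Σ_α (i_α - α)}, where
  -- Σ_α (i_α - α) = Σ_α σ(α) - Σ_α α (the image of σ is {i_1<…<i_k};
  -- 0-based indices give the same differences).
  sgnMK : ∀ {k m} → (Fin k → Fin m) → Carrier
  sgnMK {k} σ = negOnePow (inversions σ) * negOnePow (sumℕ (λ α → toℕ (σ α)) ∸ sumℕ {k} toℕ)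

  prodF : ∀ {k} → (Fin k → Carrier) → Carrier
  prodF {k} f = foldr (λ a p → f a * p) 1# (allFin k)

  sumL : List Carrier → Carrier
  sumL = foldr _+_ 0#

  cullisDet : ∀ {m k} → Mat m k → Carrier
  cullisDet {m} {k} X =
    sumL (map (λ σ → sgnMK σ * prodF (λ α → X (σ α) α)) (injections k m))

  L⁻ : ∀ {n k} → Mat n k → Mat (n ∸ 1) k
  L⁻ {zero}  X ()
  L⁻ {suc n} X r j = X (inject₁ r) j - X (fromℕ n) j

  L⁺ : ∀ {n k} → Mat (n ∸ 1) k → Mat n k
  L⁺ {zero}  Y ()
  L⁺ {suc n} Y = VF.insertAt Y (fromℕ n) (λ _ → 0#)

{-# OPTIONS --safe #-}
module Submission where

-- Since S = L⁻ ∘ T ∘ L⁺, it suffices that det (L⁺ Y) = det Y and, for n + k odd, det (L⁻ X) = det X;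
-- of T only det ∘ T = det is used.
-- Everything rests on the expansion along the first column, det X = Σᵢ (−1)^i x_{i1} det X_{i1},
-- obtained from the definition by splitting the injections σ according to σ(1).
-- A zero last row contributes nothing to it, and deleting that row commutes with taking minors;
-- this gives the claim for L⁺. Next, L⁻ X arises from X by adding −(row n) to every row and deleting
-- the resulting zero last row. If m + k is odd, adding a vector v to every row of an m × k matrix
-- does not change det: by induction on k the change is v₁ Σᵢ (−1)^i det X_{i1}, and this alternating
-- sum of minors vanishes because, after expanding each minor once more, the terms for the ordered
-- row pairs (a, b) and (b, a) cancel.

open import Defs
open import Data.Nat.Base as ℕ using (ℕ; zero; suc; _≤_; _<_; _%_; _∸_; _<ᵇ_; z≤n; s≤s)
import Data.Nat.Properties as ℕP
open import Data.Nat.Solver using (module +-*-Solver)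
open import Data.Bool.Base using (Bool; true; false; T; _∧_; _∨_; not; if_then_else_)
open import Data.Bool.ListAction using (and)
import Data.Bool.Properties as BoolP
open import Data.Unit.Base using (tt)
open import Data.Empty using (⊥-elim)
open import Data.Fin.Base using (Fin; zero; suc; toℕ; fromℕ; inject₁; punchIn; punchOut)
import Data.Fin.Properties as FinP
open import Data.List.Base using (List; []; _∷_; _++_; map; foldr; concatMap; filter; tabulate; allFin)
import Data.List.Properties as ListP
open import Data.List.Relation.Unary.All using (All; []; _∷_)
import Data.List.Relation.Unary.All.Properties as AllP
open import Data.Product.Base using (Σ; _×_; _,_; proj₁; proj₂)
open import Data.Sum.Base as Sum using (_⊎_; inj₁; inj₂)
import Data.Vec.Functional as VF
open import Data.Vec.Functional.Properties using (∷-cong; insertAt-lookup; insertAt-punchIn)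
open import Function using (id; _∘_; _⇔_; mk⇔; Equivalence)
open import Function.Definitions using (Injective)
open import Function.Properties.Equivalence using () renaming (sym to ⇔-sym; trans to ⇔-trans)
open import Relation.Nullary using (¬_; yes; no; contradiction; ⌊_⌋)
open import Relation.Nullary.Decidable using (T?; does)
open import Relation.Unary using (Pred; Decidable)
open import Relation.Binary.PropositionalEquality as ≡ using (_≡_; _≢_; _≗_)
open import Algebra.Bundles using (Monoid; CommutativeMonoid)
import Algebra.Properties.CommutativeMonoid.Sum as CommutativeMonoidSum

open Equivalence using (to; from)

module _ where
  open import Data.Nat.Base using (_+_)
  open ≡
  open import Algebra.Properties.CommutativeSemigroup ℕP.+-commutativeSemigroup using (x∙yz≈y∙xz)

  ⟦_⟧ : Bool → ℕ
  ⟦ true ⟧  = 1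
  ⟦ false ⟧ = 0

  module ℕ-Sum = CommutativeMonoidSum ℕP.+-0-commutativeMonoid
  open ℕ-Sum public using () renaming (sum to ∑ℕ)

  ∑ℕ-suc : ∀ {k} (f : Fin k → ℕ) → ∑ℕ (suc ∘ f) ≡ k + ∑ℕ f
  ∑ℕ-suc {zero}  f = refl
  ∑ℕ-suc {suc k} f = cong suc (trans (cong (f zero +_) (∑ℕ-suc (f ∘ suc))) (x∙yz≈y∙xz (f zero) k _))

  injective⇒∑ℕ-toℕ≤ : ∀ m {k} (f : Fin k → ℕ) → (∀ α → f α < m) → Injective _≡_ _≡_ f →
                      k ≤ m × ∑ℕ {k} toℕ ≤ ∑ℕ f
  injective⇒∑ℕ-toℕ≤ zero    {zero}  f f<m f-inj = z≤n , z≤n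
  injective⇒∑ℕ-toℕ≤ zero    {suc k} f f<m f-inj = contradiction (f<m zero) ℕP.n≮0
  injective⇒∑ℕ-toℕ≤ (suc m) {zero}  f f<m f-inj = z≤n , z≤n
  injective⇒∑ℕ-toℕ≤ (suc m) {suc k} f f<m f-inj with FinP.any? (λ α → f α ℕP.≟ m)
  ... | yes (α , fα≡m) = s≤s k≤m , ∑≤
    where
      g = VF.removeAt f α
      g<m : ∀ j → g j < m
      g<m j = ℕP.≤∧≢⇒< (ℕP.≤-pred (f<m (punchIn α j)))
                       (λ gj≡m → FinP.punchInᵢ≢i α j (f-inj (trans gj≡m (sym fα≡m))))
      IH = injective⇒∑ℕ-toℕ≤ m g g<m (FinP.punchIn-injective α _ _ ∘ f-inj)
      k≤m = proj₁ IH
      ∑≤ : ∑ℕ {suc k} toℕ ≤ ∑ℕ f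
      ∑≤ = begin
        ∑ℕ {suc k} toℕ      ≡⟨ ∑ℕ-suc {k} toℕ ⟩
        k + ∑ℕ {k} toℕ      ≤⟨ ℕP.+-mono-≤ k≤m (proj₂ IH) ⟩
        m + ∑ℕ g            ≡⟨ cong (_+ ∑ℕ g) fα≡m ⟨
        f α + ∑ℕ g          ≡⟨ ℕ-Sum.sum-remove {i = α} f ⟨
        ∑ℕ f                ∎
        where open ℕP.≤-Reasoning
  ... | no ∄α = ℕP.m≤n⇒m≤1+n (proj₁ IH) , proj₂ IH
    where
      f<m′ : ∀ α → f α < m
      f<m′ α = ℕP.≤∧≢⇒< (ℕP.≤-pred (f<m α)) (λ fα≡m → ∄α (α , fα≡m))
      IH = injective⇒∑ℕ-toℕ≤ m f f<m′ f-inj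

  toℕ-punchIn : ∀ {n} (i : Fin (suc n)) (x : Fin n) → toℕ (punchIn i x) + ⟦ toℕ x <ᵇ toℕ i ⟧ ≡ suc (toℕ x)
  toℕ-punchIn zero    x       = ℕP.+-identityʳ _
  toℕ-punchIn (suc i) zero    = refl
  toℕ-punchIn (suc i) (suc x) = cong suc (toℕ-punchIn i x)

  punchIn-<ᵇ : ∀ {n} (i : Fin (suc n)) (x : Fin n) → (toℕ (punchIn i x) <ᵇ toℕ i) ≡ (toℕ x <ᵇ toℕ i)
  punchIn-<ᵇ zero    x       = refl
  punchIn-<ᵇ (suc i) zero    = refl
  punchIn-<ᵇ (suc i) (suc x) = punchIn-<ᵇ i x

  punchIn-<ᵇ-punchIn : ∀ {n} (i : Fin (suc n)) (x y : Fin n) →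
                       (toℕ (punchIn i x) <ᵇ toℕ (punchIn i y)) ≡ (toℕ x <ᵇ toℕ y)
  punchIn-<ᵇ-punchIn zero    x       y       = refl
  punchIn-<ᵇ-punchIn (suc i) zero    zero    = refl
  punchIn-<ᵇ-punchIn (suc i) zero    (suc y) = refl
  punchIn-<ᵇ-punchIn (suc i) (suc x) zero    = refl
  punchIn-<ᵇ-punchIn (suc i) (suc x) (suc y) = punchIn-<ᵇ-punchIn i x y

  punchIn-fromℕ : ∀ {n} (i : Fin n) → punchIn (fromℕ n) i ≡ inject₁ i
  punchIn-fromℕ zero    = refl
  punchIn-fromℕ (suc i) = cong suc (punchIn-fromℕ i)

  punchIn-inject₁-inject₁ : ∀ {n} (i : Fin (suc n)) (r : Fin n) →
                            punchIn (inject₁ i) (inject₁ r) ≡ inject₁ (punchIn i r)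
  punchIn-inject₁-inject₁ zero    r       = refl
  punchIn-inject₁-inject₁ (suc i) zero    = refl
  punchIn-inject₁-inject₁ (suc i) (suc r) = cong suc (punchIn-inject₁-inject₁ i r)

  punchIn-inject₁-fromℕ : ∀ {n} (i : Fin (suc n)) → punchIn (inject₁ i) (fromℕ n) ≡ fromℕ (suc n)
  punchIn-inject₁-fromℕ          zero    = refl
  punchIn-inject₁-fromℕ {suc n} (suc i) = cong suc (punchIn-inject₁-fromℕ i)

  punchIn-punchIn-punchOut : ∀ {n} (b : Fin (suc (suc n))) (i : Fin (suc n)) (p : punchIn b i ≢ b) (r : Fin n) →
                             punchIn (punchIn b i) (punchIn (punchOut p) r) ≡ punchIn b (punchIn i r)
  punchIn-punchIn-punchOut zero    i       p r       = refl
  punchIn-punchIn-punchOut (suc b) zero    p r       = refl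
  punchIn-punchIn-punchOut (suc b) (suc i) p zero    = refl
  punchIn-punchIn-punchOut (suc b) (suc i) p (suc r) = cong suc (punchIn-punchIn-punchOut b i (p ∘ cong suc) r)

  toℕ-punchIn+toℕ-punchOut : ∀ {n} (b : Fin (suc (suc n))) (i : Fin (suc n)) (p : punchIn b i ≢ b) →
                             suc (toℕ (punchIn b i) + toℕ (punchOut p)) ≡ toℕ b + toℕ i ⊎
                             toℕ (punchIn b i) + toℕ (punchOut p) ≡ suc (toℕ b + toℕ i)
  toℕ-punchIn+toℕ-punchOut zero    i       p = inj₂ (cong suc (ℕP.+-identityʳ _))
  toℕ-punchIn+toℕ-punchOut (suc b) zero    p = inj₁ (cong suc (sym (ℕP.+-identityʳ _)))
  toℕ-punchIn+toℕ-punchOut {suc n} (suc b) (suc i) p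
    rewrite ℕP.+-suc (toℕ (punchIn b i)) (toℕ (punchOut (p ∘ cong suc))) | ℕP.+-suc (toℕ b) (toℕ i)
    = Sum.map (cong (2 +_)) (cong (2 +_)) (toℕ-punchIn+toℕ-punchOut b i (p ∘ cong suc))

  [1+m]+[1+k]%2≡1⇒[m+k]%2≡1 : ∀ m k → (suc m + suc k) % 2 ≡ 1 → (m + k) % 2 ≡ 1
  [1+m]+[1+k]%2≡1⇒[m+k]%2≡1 m k = subst (λ x → suc x % 2 ≡ 1) (ℕP.+-suc m k)

T-and : ∀ bs → T (and bs) ⇔ All T bs
T-and []       = mk⇔ (λ _ → []) (λ _ → tt)
T-and (b ∷ bs) = mk⇔ (λ t → let (tb , tbs) = to BoolP.T-∧ t in tb ∷ to (T-and bs) tbs)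
                     (λ { (tb ∷ tbs) → from BoolP.T-∧ (tb , from (T-and bs) tbs) })

T-injective : ∀ {a b} → (T a ⇔ T b) → a ≡ b
T-injective {true}  {true}  _   = ≡.refl
T-injective {true}  {false} a⇔b = contradiction (to a⇔b tt) λ ()
T-injective {false} {true}  a⇔b = contradiction (from a⇔b tt) λ ()
T-injective {false} {false} _   = ≡.refl

T-distinct : ∀ {k m} (α β : Fin k) (x y : Fin m) →
             T (⌊ α FinP.≟ β ⌋ ∨ not ⌊ x FinP.≟ y ⌋) ⇔ (x ≡ y → α ≡ β)
T-distinct α β x y with α FinP.≟ β | x FinP.≟ y
... | yes α≡β | _       = mk⇔ (λ _ _ → α≡β) (λ _ → tt)
... | no _    | no x≢y  = mk⇔ (λ _ x≡y → contradiction x≡y x≢y) (λ _ → tt)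
... | no α≢β  | yes x≡y = mk⇔ (λ ()) (λ x≡y⇒α≡β → α≢β (x≡y⇒α≡β x≡y))

cons-punchIn-injective : ∀ {k m} (i : Fin (suc m)) (τ : Fin k → Fin m) →
                         Injective _≡_ _≡_ (i VF.∷ punchIn i ∘ τ) ⇔ Injective _≡_ _≡_ τ
cons-punchIn-injective i τ = mk⇔ tail-injective cons-injective
  where
    tail-injective : Injective _≡_ _≡_ (i VF.∷ punchIn i ∘ τ) → Injective _≡_ _≡_ τ
    tail-injective inj τα≡τβ = FinP.suc-injective (inj (≡.cong (punchIn i) τα≡τβ))
    cons-injective : Injective _≡_ _≡_ τ → Injective _≡_ _≡_ (i VF.∷ punchIn i ∘ τ)
    cons-injective inj {zero}  {zero}  _  = ≡.refl
    cons-injective inj {zero}  {suc β} eq = contradiction (≡.sym eq) (FinP.punchInᵢ≢i i (τ β))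
    cons-injective inj {suc α} {zero}  eq = contradiction eq (FinP.punchInᵢ≢i i (τ α))
    cons-injective inj {suc α} {suc β} eq = ≡.cong suc (inj (FinP.punchIn-injective i _ _ eq))

module SumMap {a ℓ} (M : Monoid a ℓ) where
  open Monoid M
  open import Algebra.Properties.Monoid.Sum M using (sum)

  sumMap : {A : Set} → (A → Carrier) → List A → Carrier
  sumMap g = foldr (λ x s → g x ∙ s) ε

  private variable
    A B : Set

  sumMap-cong : {g h : A → Carrier} → (∀ x → g x ≈ h x) → ∀ xs → sumMap g xs ≈ sumMap h xs
  sumMap-cong g≈h []       = refl
  sumMap-cong g≈h (x ∷ xs) = ∙-cong (g≈h x) (sumMap-cong g≈h xs)

  sumMap-ε : {g : A → Carrier} → (∀ x → g x ≈ ε) → ∀ xs → sumMap g xs ≈ ε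
  sumMap-ε g≈ε []       = refl
  sumMap-ε g≈ε (x ∷ xs) = trans (∙-cong (g≈ε x) (sumMap-ε g≈ε xs)) (identityˡ ε)

  sumMap-++ : ∀ (g : A → Carrier) xs ys → sumMap g (xs ++ ys) ≈ sumMap g xs ∙ sumMap g ys
  sumMap-++ g []       ys = sym (identityˡ _)
  sumMap-++ g (x ∷ xs) ys = trans (∙-congˡ (sumMap-++ g xs ys)) (sym (assoc _ _ _))

  sumMap-concatMap : ∀ (g : B → Carrier) (h : A → List B) xs →
                     sumMap g (concatMap h xs) ≈ sumMap (sumMap g ∘ h) xs
  sumMap-concatMap g h []       = refl
  sumMap-concatMap g h (x ∷ xs) =
    trans (sumMap-++ g (h x) (concatMap h xs)) (∙-congˡ (sumMap-concatMap g h xs))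

  sumMap-filter : ∀ {p} {P : Pred A p} (P? : Decidable P) (g : A → Carrier) xs →
                  sumMap g (filter P? xs) ≈ sumMap (λ x → if does (P? x) then g x else ε) xs
  sumMap-filter P? g []       = refl
  sumMap-filter P? g (x ∷ xs) with does (P? x)
  ... | true  = ∙-congˡ (sumMap-filter P? g xs)
  ... | false = trans (sumMap-filter P? g xs) (sym (identityˡ _))

  sumMap-tabulate : ∀ {n} (g : A → Carrier) (h : Fin n → A) →
                    sumMap g (tabulate h) ≡ sum (g ∘ h)
  sumMap-tabulate {n = zero}  g h = ≡.refl
  sumMap-tabulate {n = suc n} g h = ≡.cong (g (h zero) ∙_) (sumMap-tabulate g (h ∘ suc))

module OffDiagonal {a ℓ} (M : CommutativeMonoid a ℓ) where
  open CommutativeMonoid M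
  open import Algebra.Properties.CommutativeMonoid.Sum M using (sum-syntax; sum-cong-≋; sum-cong-≗; sum-remove; ∑-comm)
  open import Relation.Binary.Reasoning.Setoid setoid

  -- Both sides sum f over the ordered pairs of distinct indices (a, punchIn a j) = (punchIn b i, b).
  ∑-punchIn-transpose : ∀ {n} (f : Fin (suc n) → Fin n → Carrier) →
    ∑[ a < suc n ] ∑[ j < n ] f a j ≈ ∑[ b < suc n ] ∑[ i < n ] f (punchIn b i) (punchOut (FinP.punchInᵢ≢i b i))
  ∑-punchIn-transpose {n} f = begin
    ∑[ a < suc n ] ∑[ j < n ] f a j                                        ≈⟨ sum-cong-≋ {suc n} row ⟨
    ∑[ a < suc n ] ∑[ b < suc n ] g a b                                    ≈⟨ ∑-comm g ⟩
    ∑[ b < suc n ] ∑[ a < suc n ] g a b                                    ≈⟨ sum-cong-≋ {suc n} column ⟩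
    ∑[ b < suc n ] ∑[ i < n ] f (punchIn b i) (punchOut (FinP.punchInᵢ≢i b i)) ∎
    where
      g : Fin (suc n) → Fin (suc n) → Carrier
      g a b with a FinP.≟ b
      ... | yes _   = ε
      ... | no  a≢b = f a (punchOut a≢b)

      g-diagonal : ∀ a → g a a ≈ ε
      g-diagonal a with a FinP.≟ a
      ... | yes _   = refl
      ... | no  a≢a = contradiction ≡.refl a≢a

      g-off-diagonal : ∀ {a b} (a≢b : a ≢ b) → g a b ≈ f a (punchOut a≢b)
      g-off-diagonal {a} {b} a≢b with a FinP.≟ b
      ... | yes a≡b = contradiction a≡b a≢b
      ... | no  _   = reflexive (≡.cong (f a) (FinP.punchOut-cong a ≡.refl))

      row : ∀ a → ∑[ b < suc n ] g a b ≈ ∑[ j < n ] f a j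
      row a = begin
        ∑[ b < suc n ] g a b
          ≈⟨ sum-remove {i = a} (g a) ⟩
        g a a ∙ ∑[ j < n ] g a (punchIn a j)
          ≈⟨ ∙-cong (g-diagonal a) (sum-cong-≋ {n} (λ j → g-off-diagonal _)) ⟩
        ε ∙ ∑[ j < n ] f a (punchOut (FinP.punchInᵢ≢i a j ∘ ≡.sym))
          ≈⟨ identityˡ _ ⟩
        ∑[ j < n ] f a (punchOut (FinP.punchInᵢ≢i a j ∘ ≡.sym))
          ≡⟨ sum-cong-≗ {n} (λ j → ≡.cong (f a) (FinP.punchOut-punchIn a)) ⟩
        ∑[ j < n ] f a j
          ∎

      column : ∀ b → ∑[ a < suc n ] g a b ≈ ∑[ i < n ] f (punchIn b i) (punchOut (FinP.punchInᵢ≢i b i))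
      column b = begin
        ∑[ a < suc n ] g a b
          ≈⟨ sum-remove {i = b} (λ a → g a b) ⟩
        g b b ∙ ∑[ i < n ] g (punchIn b i) b
          ≈⟨ ∙-cong (g-diagonal b) (sum-cong-≋ {n} (λ i → g-off-diagonal _)) ⟩
        ε ∙ ∑[ i < n ] f (punchIn b i) (punchOut (FinP.punchInᵢ≢i b i))
          ≈⟨ identityˡ _ ⟩
        ∑[ i < n ] f (punchIn b i) (punchOut (FinP.punchInᵢ≢i b i))
          ∎

module IndexMaps {c ℓ} (F : Field c ℓ) where
  open import Data.Nat.Base using (_+_)
  open ≡
  open SumMap ℕP.+-0-monoid
  open ℕ-Sum using (sum-cong-≗; ∑-distrib-+)

  sumℕ≡∑ℕ : ∀ {k} (f : Fin k → ℕ) → sumℕ F f ≡ ∑ℕ f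
  sumℕ≡∑ℕ f = sumMap-tabulate f id

  isInversion : ∀ {k m} → (Fin k → Fin m) → Fin k → Fin k → Bool
  isInversion σ α β = (toℕ α <ᵇ toℕ β) ∧ (toℕ (σ β) <ᵇ toℕ (σ α))

  -- `inversions` counts with an indicator local to its definition; unification recovers the summand.
  private
    inversionSummand : ∀ {k m} (σ : Fin k → Fin m) →
      Σ (Fin k → Fin k → ℕ) λ h → inversions F σ ≡ sumMap id (concatMap (λ α → map (h α) (allFin k)) (allFin k))
    inversionSummand σ = _ , refl

    inversionSummand-spec : ∀ {k m} (σ : Fin k → Fin m) α β → proj₁ (inversionSummand σ) α β ≡ ⟦ isInversion σ α β ⟧
    inversionSummand-spec σ α β with isInversion σ α β
    ... | true  = refl
    ... | false = refl

  inversions≡∑∑ : ∀ {k m} (σ : Fin k → Fin m) →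
                  inversions F σ ≡ ∑ℕ (λ α → ∑ℕ (λ β → ⟦ isInversion σ α β ⟧))
  inversions≡∑∑ {k} σ = begin
    inversions F σ
      ≡⟨ proj₂ (inversionSummand σ) ⟩
    sumMap id (concatMap (λ α → map (h α) (allFin k)) (allFin k))
      ≡⟨ sumMap-concatMap id (λ α → map (h α) (allFin k)) (allFin k) ⟩
    sumMap (λ α → sumMap id (map (h α) (allFin k))) (allFin k)
      ≡⟨ sumMap-tabulate {n = k} (λ α → sumMap id (map (h α) (allFin k))) id ⟩
    ∑ℕ (λ α → sumMap id (map (h α) (allFin k)))
      ≡⟨ sum-cong-≗ (λ α → trans (ListP.foldr-map _ (h α) 0 (allFin k)) (sumMap-tabulate (h α) id)) ⟩
    ∑ℕ (λ α → ∑ℕ (h α))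
      ≡⟨ sum-cong-≗ (λ α → sum-cong-≗ (inversionSummand-spec σ α)) ⟩
    ∑ℕ (λ α → ∑ℕ (λ β → ⟦ isInversion σ α β ⟧))
      ∎
    where
      open ≡-Reasoning
      h = proj₁ (inversionSummand σ)

  inversions-cong : ∀ {k m} {σ σ′ : Fin k → Fin m} → σ ≗ σ′ → inversions F σ ≡ inversions F σ′
  inversions-cong {σ = σ} {σ′} σ≗σ′ = begin
    inversions F σ                                 ≡⟨ inversions≡∑∑ σ ⟩
    ∑ℕ (λ α → ∑ℕ (λ β → ⟦ isInversion σ α β ⟧))   ≡⟨ sum-cong-≗ (λ α → sum-cong-≗ (λ β → isInversion≡ α β)) ⟩
    ∑ℕ (λ α → ∑ℕ (λ β → ⟦ isInversion σ′ α β ⟧))  ≡⟨ inversions≡∑∑ σ′ ⟨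
    inversions F σ′                                ∎
    where
      open ≡-Reasoning
      isInversion≡ : ∀ α β → ⟦ isInversion σ α β ⟧ ≡ ⟦ isInversion σ′ α β ⟧
      isInversion≡ α β = cong₂ (λ x y → ⟦ (toℕ α <ᵇ toℕ β) ∧ (toℕ x <ᵇ toℕ y) ⟧) (σ≗σ′ β) (σ≗σ′ α)

  inversions-cons : ∀ {k m} (i : Fin (suc m)) (τ : Fin k → Fin m) →
                    inversions F (i VF.∷ punchIn i ∘ τ) ≡ ∑ℕ (λ β → ⟦ toℕ (τ β) <ᵇ toℕ i ⟧) + inversions F τ
  inversions-cons i τ = begin
    inversions F (i VF.∷ punchIn i ∘ τ)
      ≡⟨ inversions≡∑∑ (i VF.∷ punchIn i ∘ τ) ⟩
    ∑ℕ (λ β → ⟦ toℕ (punchIn i (τ β)) <ᵇ toℕ i ⟧) +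
    ∑ℕ (λ α → ∑ℕ (λ β → ⟦ isInversion (punchIn i ∘ τ) α β ⟧))
      ≡⟨ cong₂ _+_ (sum-cong-≗ (λ β → cong ⟦_⟧ (punchIn-<ᵇ i (τ β))))
                   (sum-cong-≗ (λ α → sum-cong-≗ (λ β →
                     cong (λ b → ⟦ (toℕ α <ᵇ toℕ β) ∧ b ⟧) (punchIn-<ᵇ-punchIn i (τ β) (τ α))))) ⟩
    ∑ℕ (λ β → ⟦ toℕ (τ β) <ᵇ toℕ i ⟧) + ∑ℕ (λ α → ∑ℕ (λ β → ⟦ isInversion τ α β ⟧))
      ≡⟨ cong (_ +_) (inversions≡∑∑ τ) ⟨
    ∑ℕ (λ β → ⟦ toℕ (τ β) <ᵇ toℕ i ⟧) + inversions F τ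
      ∎
    where open ≡-Reasoning

  signExponent : ∀ {k m} → (Fin k → Fin m) → ℕ
  signExponent {k} σ = inversions F σ + (∑ℕ (toℕ ∘ σ) + ∑ℕ {k} toℕ)

  signExponent-cons : ∀ {k m} (i : Fin (suc m)) (τ : Fin k → Fin m) →
                      signExponent (i VF.∷ punchIn i ∘ τ) ≡ (toℕ i + signExponent τ) + (k + k)
  signExponent-cons {k} i τ = begin
    signExponent (i VF.∷ punchIn i ∘ τ)
      ≡⟨ cong₂ (λ x y → x + ((toℕ i + s′) + y)) (inversions-cons i τ) (∑ℕ-suc {k} toℕ) ⟩
    (below + t) + ((toℕ i + s′) + (k + d))
      ≡⟨ solve 6 (λ b t i s′ k d → (b :+ t) :+ ((i :+ s′) :+ (k :+ d)) := (i :+ t :+ d :+ k) :+ (s′ :+ b))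
               refl below t (toℕ i) s′ k d ⟩
    (toℕ i + t + d + k) + (s′ + below)
      ≡⟨ cong (toℕ i + t + d + k +_) s′+below≡k+s ⟩
    (toℕ i + t + d + k) + (k + s)
      ≡⟨ solve 5 (λ t i s k d → (i :+ t :+ d :+ k) :+ (k :+ s) := (i :+ (t :+ (s :+ d))) :+ (k :+ k))
               refl t (toℕ i) s k d ⟩
    (toℕ i + signExponent τ) + (k + k)
      ∎
    where
      open ≡-Reasoning
      open +-*-Solver using (solve; _:+_; _:=_)
      below = ∑ℕ (λ β → ⟦ toℕ (τ β) <ᵇ toℕ i ⟧)
      t = inversions F τ
      s = ∑ℕ (toℕ ∘ τ)
      s′ = ∑ℕ (toℕ ∘ punchIn i ∘ τ)
      d = ∑ℕ {k} toℕ
      s′+below≡k+s : s′ + below ≡ k + s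
      s′+below≡k+s = begin
        s′ + below                                             ≡⟨ ∑-distrib-+ (toℕ ∘ punchIn i ∘ τ) _ ⟨
        ∑ℕ (λ β → toℕ (punchIn i (τ β)) + ⟦ toℕ (τ β) <ᵇ toℕ i ⟧) ≡⟨ sum-cong-≗ (toℕ-punchIn i ∘ τ) ⟩
        ∑ℕ (suc ∘ toℕ ∘ τ)                                     ≡⟨ ∑ℕ-suc (toℕ ∘ τ) ⟩
        k + s                                                  ∎

  T-isInjective : ∀ {k m} (σ : Fin k → Fin m) → T (isInjective F σ) ⇔ Injective _≡_ _≡_ σ
  T-isInjective {k} σ = mk⇔ sound complete
    where
      sound : T (isInjective F σ) → Injective _≡_ _≡_ σ
      sound t {α} {β} = to (T-distinct α β (σ α) (σ β))
        (AllP.tabulate⁻ (AllP.map⁻ (AllP.tabulate⁻ (AllP.map⁻ (AllP.concat⁻ (to (T-and _) t))) α)) β)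
      complete : Injective _≡_ _≡_ σ → T (isInjective F σ)
      complete inj = from (T-and _) (AllP.concat⁺ (AllP.map⁺ (AllP.tabulate⁺ λ α →
        AllP.map⁺ (AllP.tabulate⁺ λ β → from (T-distinct α β (σ α) (σ β)) inj))))

  isInjective-cons : ∀ {k m} (i : Fin (suc m)) (τ : Fin k → Fin m) →
                     isInjective F (i VF.∷ punchIn i ∘ τ) ≡ isInjective F τ
  isInjective-cons i τ =
    T-injective (⇔-trans (T-isInjective _) (⇔-trans (cons-punchIn-injective i τ) (⇔-sym (T-isInjective τ))))

  isInjective-cong : ∀ {k m} {σ σ′ : Fin k → Fin m} → σ ≗ σ′ → isInjective F σ ≡ isInjective F σ′
  isInjective-cong {σ = σ} {σ′} σ≗σ′ =
    T-injective (⇔-trans (T-isInjective σ) (⇔-trans (mk⇔ transport transport′) (⇔-sym (T-isInjective σ′))))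
    where
      transport : Injective _≡_ _≡_ σ → Injective _≡_ _≡_ σ′
      transport inj eq = inj (trans (σ≗σ′ _) (trans eq (sym (σ≗σ′ _))))
      transport′ : Injective _≡_ _≡_ σ′ → Injective _≡_ _≡_ σ
      transport′ inj eq = inj (trans (sym (σ≗σ′ _)) (trans eq (σ≗σ′ _)))

module CullisDeterminant {c ℓ} (F : Field c ℓ) where
  open Field F hiding (zero)
  open import Algebra.Properties.Ring ring using (-‿distribˡ-*; -‿distribʳ-*; -‿involutive)
  open import Algebra.Properties.Semiring.Sum semiring
    using (sum-syntax; sum-cong-≋; sum-cong-≗; sum-replicate-zero; ∑-distrib-+; sum-remove; sum-init-last; *-distribˡ-sum)
  open import Algebra.Properties.CommutativeSemigroup *-commutativeSemigroup
    using (interchange; x∙yz≈y∙xz)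
  open SumMap +-monoid
  module Product = SumMap *-monoid
  module ℕ-SumMap = SumMap ℕP.+-0-monoid
  open import Relation.Binary.Reasoning.Setoid setoid
  open IndexMaps F

  infix 8 −1^_
  −1^_ : ℕ → Carrier
  −1^_ = negOnePow F

  −1^-+ : ∀ a b → −1^ (a ℕ.+ b) ≈ −1^ a * −1^ b
  −1^-+ zero    b = sym (*-identityˡ _)
  −1^-+ (suc a) b = trans (-‿cong (−1^-+ a b)) (-‿distribˡ-* _ _)

  −1^-square : ∀ a → −1^ a * −1^ a ≈ 1#
  −1^-square zero    = *-identityˡ 1#
  −1^-square (suc a) = begin
    - −1^ a * - −1^ a      ≈⟨ -‿distribˡ-* _ _ ⟨
    - (−1^ a * - −1^ a)    ≈⟨ -‿cong (-‿distribʳ-* _ _) ⟨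
    - - (−1^ a * −1^ a)    ≈⟨ -‿involutive _ ⟩
    −1^ a * −1^ a          ≈⟨ −1^-square a ⟩
    1#                     ∎

  −1^-+-double : ∀ a b → −1^ (a ℕ.+ (b ℕ.+ b)) ≈ −1^ a
  −1^-+-double a b = begin
    −1^ (a ℕ.+ (b ℕ.+ b))    ≈⟨ −1^-+ a (b ℕ.+ b) ⟩
    −1^ a * −1^ (b ℕ.+ b)    ≈⟨ *-congˡ (−1^-+ b b) ⟩
    −1^ a * (−1^ b * −1^ b)  ≈⟨ *-congˡ (−1^-square b) ⟩
    −1^ a * 1#               ≈⟨ *-identityʳ _ ⟩
    −1^ a                    ∎

  −1^-∸ : ∀ {a b} → b ≤ a → −1^ (a ∸ b) ≈ −1^ (a ℕ.+ b)
  −1^-∸ {a} {b} b≤a = begin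
    −1^ (a ∸ b)                  ≈⟨ −1^-+-double (a ∸ b) b ⟨
    −1^ ((a ∸ b) ℕ.+ (b ℕ.+ b))  ≡⟨ ≡.cong −1^_ (ℕP.+-assoc (a ∸ b) b b) ⟨
    −1^ ((a ∸ b) ℕ.+ b ℕ.+ b)    ≡⟨ ≡.cong (λ x → −1^ (x ℕ.+ b)) (ℕP.m∸n+n≡m b≤a) ⟩
    −1^ (a ℕ.+ b)                ∎

  −1^-adjacent : ∀ {a b} → suc a ≡ b ⊎ a ≡ suc b → −1^ a ≈ - −1^ b
  −1^-adjacent (inj₁ ≡.refl) = sym (-‿involutive _)
  −1^-adjacent (inj₂ ≡.refl) = refl

  ∑-−1^≈0 : ∀ n → (n ℕ.+ 1) % 2 ≡ 1 → ∑[ i < n ] (−1^ toℕ i) ≈ 0#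
  ∑-−1^≈0 zero          _   = refl
  ∑-−1^≈0 (suc (suc n)) odd = begin
    1# + (- 1# + ∑[ i < n ] (- - −1^ toℕ i))  ≈⟨ +-congˡ (+-congˡ (sum-cong-≋ {n} (λ i → -‿involutive _))) ⟩
    1# + (- 1# + ∑[ i < n ] (−1^ toℕ i))      ≈⟨ +-assoc _ _ _ ⟨
    (1# + - 1#) + ∑[ i < n ] (−1^ toℕ i)      ≈⟨ +-congʳ (-‿inverseʳ 1#) ⟩
    0# + ∑[ i < n ] (−1^ toℕ i)               ≈⟨ +-identityˡ _ ⟩
    ∑[ i < n ] (−1^ toℕ i)                    ≈⟨ ∑-−1^≈0 n odd ⟩
    0#                                        ∎

  ∑≈0 : ∀ {n} {f : Fin n → Carrier} → (∀ i → f i ≈ 0#) → ∑[ i < n ] f i ≈ 0#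
  ∑≈0 {n} f≈0 = trans (sum-cong-≋ f≈0) (sum-replicate-zero n)

  -- The truncated subtraction in `sgnMK` is exact: an injective σ has Σ σ ≥ Σ_{α<k} α.
  sgnMK≈−1^signExponent : ∀ {k m} (σ : Fin k → Fin m) → Injective _≡_ _≡_ σ → sgnMK F σ ≈ −1^ signExponent σ
  sgnMK≈−1^signExponent {k} {m} σ inj = begin
    −1^ inversions F σ * −1^ (sumℕ F (toℕ ∘ σ) ∸ sumℕ F {k} toℕ)
      ≡⟨ ≡.cong₂ (λ a b → −1^ inversions F σ * −1^ (a ∸ b)) (sumℕ≡∑ℕ (toℕ ∘ σ)) (sumℕ≡∑ℕ {k} toℕ) ⟩
    −1^ inversions F σ * −1^ (∑ℕ (toℕ ∘ σ) ∸ ∑ℕ {k} toℕ)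
      ≈⟨ *-congˡ (−1^-∸ ∑toℕ≤∑σ) ⟩
    −1^ inversions F σ * −1^ (∑ℕ (toℕ ∘ σ) ℕ.+ ∑ℕ {k} toℕ)
      ≈⟨ −1^-+ (inversions F σ) _ ⟨
    −1^ signExponent σ
      ∎
    where
      ∑toℕ≤∑σ : ∑ℕ {k} toℕ ≤ ∑ℕ (toℕ ∘ σ)
      ∑toℕ≤∑σ = proj₂ (injective⇒∑ℕ-toℕ≤ m (toℕ ∘ σ) (FinP.toℕ<n ∘ σ) (inj ∘ FinP.toℕ-injective))

  sgnMK-cons : ∀ {k m} (i : Fin (suc m)) (τ : Fin k → Fin m) → Injective _≡_ _≡_ τ →
               sgnMK F (i VF.∷ punchIn i ∘ τ) ≈ −1^ toℕ i * sgnMK F τ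
  sgnMK-cons {k} i τ inj = begin
    sgnMK F (i VF.∷ punchIn i ∘ τ)                  ≈⟨ sgnMK≈−1^signExponent _ (from (cons-punchIn-injective i τ) inj) ⟩
    −1^ signExponent (i VF.∷ punchIn i ∘ τ)         ≡⟨ ≡.cong −1^_ (signExponent-cons i τ) ⟩
    −1^ ((toℕ i ℕ.+ signExponent τ) ℕ.+ (k ℕ.+ k))  ≈⟨ −1^-+-double (toℕ i ℕ.+ signExponent τ) k ⟩
    −1^ (toℕ i ℕ.+ signExponent τ)                  ≈⟨ −1^-+ (toℕ i) (signExponent τ) ⟩
    −1^ toℕ i * −1^ signExponent τ                  ≈⟨ *-congˡ (sgnMK≈−1^signExponent τ inj) ⟨
    −1^ toℕ i * sgnMK F τ                           ∎

  sgnMK-cong : ∀ {k m} {σ σ′ : Fin k → Fin m} → σ ≗ σ′ → sgnMK F σ ≡ sgnMK F σ′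
  sgnMK-cong {k} σ≗σ′ = ≡.cong₂ (λ a b → −1^ a * −1^ (b ∸ sumℕ F {k} toℕ)) (inversions-cong σ≗σ′)
                                (ℕ-SumMap.sumMap-cong (λ α → ≡.cong toℕ (σ≗σ′ α)) (allFin k))

  prodF-cong : ∀ {k} {f g : Fin k → Carrier} → (∀ α → f α ≈ g α) → prodF F f ≈ prodF F g
  prodF-cong {k} f≈g = Product.sumMap-cong f≈g (allFin k)

  prodF-suc : ∀ {k} (f : Fin (suc k) → Carrier) → prodF F f ≡ f zero * prodF F (f ∘ suc)
  prodF-suc {k} f = ≡.cong (f zero *_)
    (≡.trans (Product.sumMap-tabulate f suc) (≡.sym (Product.sumMap-tabulate (f ∘ suc) id)))

  *-distribˡ-sumMap : ∀ {A : Set} a (g : A → Carrier) xs → sumMap (λ x → a * g x) xs ≈ a * sumMap g xs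
  *-distribˡ-sumMap a g []       = sym (zeroʳ a)
  *-distribˡ-sumMap a g (x ∷ xs) = trans (+-congˡ (*-distribˡ-sumMap a g xs)) (sym (distribˡ a _ _))

  sumMap-allMaps-suc : ∀ {k m} (g : (Fin (suc k) → Fin m) → Carrier) →
                       sumMap g (allMaps F (suc k) m) ≈ ∑[ j < m ] sumMap (λ f → g (j VF.∷ f)) (allMaps F k m)
  sumMap-allMaps-suc {k} {m} g = begin
    sumMap g (allMaps F (suc k) m)
      ≈⟨ sumMap-concatMap g (λ j → map (j VF.∷_) (allMaps F k m)) (allFin m) ⟩
    sumMap (λ j → sumMap g (map (j VF.∷_) (allMaps F k m))) (allFin m)
      ≡⟨ sumMap-tabulate {n = m} (λ j → sumMap g (map (j VF.∷_) (allMaps F k m))) id ⟩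
    ∑[ j < m ] sumMap g (map (j VF.∷_) (allMaps F k m))
      ≡⟨ sum-cong-≗ (λ j → ListP.foldr-map _ (j VF.∷_) 0# (allMaps F k m)) ⟩
    ∑[ j < m ] sumMap (λ f → g (j VF.∷ f)) (allMaps F k m)
      ∎

  sumMap-allMaps-punchIn : ∀ {k m} (i : Fin (suc m)) (G : (Fin k → Fin (suc m)) → Carrier) →
    (∀ {f f′} → f ≗ f′ → G f ≈ G f′) → (∀ f α → f α ≡ i → G f ≈ 0#) →
    sumMap G (allMaps F k (suc m)) ≈ sumMap (λ τ → G (punchIn i ∘ τ)) (allMaps F k m)
  sumMap-allMaps-punchIn {zero}      i G G-cong G-hit = +-congʳ (G-cong (λ ()))
  sumMap-allMaps-punchIn {suc k} {m} i G G-cong G-hit = begin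
    sumMap G (allMaps F (suc k) (suc m))
      ≈⟨ sumMap-allMaps-suc G ⟩
    ∑[ j < suc m ] sumMap (λ f → G (j VF.∷ f)) (allMaps F k (suc m))
      ≈⟨ sum-remove {i = i} (λ j → sumMap (λ f → G (j VF.∷ f)) (allMaps F k (suc m))) ⟩
    sumMap (λ f → G (i VF.∷ f)) (allMaps F k (suc m)) + ∑[ j < m ] sumMap (λ f → G (punchIn i j VF.∷ f)) (allMaps F k (suc m))
      ≈⟨ +-cong (sumMap-ε (λ f → G-hit _ zero ≡.refl) (allMaps F k (suc m)))
                (sum-cong-≋ {m} (λ j → sumMap-allMaps-punchIn i _ (G-cong ∘ ∷-cong ≡.refl) (λ f α → G-hit _ (suc α)))) ⟩
    0# + ∑[ j < m ] sumMap (λ τ → G (punchIn i j VF.∷ punchIn i ∘ τ)) (allMaps F k m)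
      ≈⟨ +-identityˡ _ ⟩
    ∑[ j < m ] sumMap (λ τ → G (punchIn i j VF.∷ punchIn i ∘ τ)) (allMaps F k m)
      ≈⟨ sum-cong-≋ {m} (λ j → sumMap-cong (λ τ → G-cong (∷-cong ≡.refl (λ _ → ≡.refl))) (allMaps F k m)) ⟩
    ∑[ j < m ] sumMap (λ τ → G (punchIn i ∘ (j VF.∷ τ))) (allMaps F k m)
      ≈⟨ sumMap-allMaps-suc (λ τ → G (punchIn i ∘ τ)) ⟨
    sumMap (λ τ → G (punchIn i ∘ τ)) (allMaps F (suc k) m)
      ∎

  term : ∀ {m k} → Mat F m k → (Fin k → Fin m) → Carrier
  term X σ = if isInjective F σ then sgnMK F σ * prodF F (λ α → X (σ α) α) else 0#

  cullisDet≈sumMap-term : ∀ {m k} (X : Mat F m k) → cullisDet F X ≈ sumMap (term X) (allMaps F k m)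
  cullisDet≈sumMap-term {m} {k} X = begin
    cullisDet F X
      ≡⟨ ListP.foldr-map _+_ _ 0# (injections F k m) ⟩
    sumMap (λ σ → sgnMK F σ * prodF F (λ α → X (σ α) α)) (injections F k m)
      ≈⟨ sumMap-filter (T? ∘ isInjective F) _ (allMaps F k m) ⟩
    sumMap (term X) (allMaps F k m)
      ∎

  cullisDet-cong : ∀ {m k} {X Y : Mat F m k} → (∀ i j → X i j ≈ Y i j) → cullisDet F X ≈ cullisDet F Y
  cullisDet-cong {m} {k} {X} {Y} X≈Y = begin
    cullisDet F X
      ≡⟨ ListP.foldr-map _+_ _ 0# (injections F k m) ⟩
    sumMap (λ σ → sgnMK F σ * prodF F (λ α → X (σ α) α)) (injections F k m)
      ≈⟨ sumMap-cong (λ σ → *-congˡ (prodF-cong (λ α → X≈Y (σ α) α))) (injections F k m) ⟩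
    sumMap (λ σ → sgnMK F σ * prodF F (λ α → Y (σ α) α)) (injections F k m)
      ≡⟨ ListP.foldr-map _+_ _ 0# (injections F k m) ⟨
    cullisDet F Y
      ∎

  term-cong : ∀ {m k} (X : Mat F m k) {σ σ′ : Fin k → Fin m} → σ ≗ σ′ → term X σ ≈ term X σ′
  term-cong X {σ} {σ′} σ≗σ′ rewrite isInjective-cong σ≗σ′ with isInjective F σ′
  ... | false = refl
  ... | true  = *-cong (reflexive (sgnMK-cong σ≗σ′)) (prodF-cong (λ α → reflexive (≡.cong (λ r → X r α) (σ≗σ′ α))))

  term-≈0 : ∀ {m k} (X : Mat F m k) (σ : Fin k → Fin m) → ¬ Injective _≡_ _≡_ σ → term X σ ≈ 0#
  term-≈0 X σ ¬inj with isInjective F σ | T-isInjective σ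
  ... | false | _      = refl
  ... | true  | T⇔inj = ⊥-elim (¬inj (to T⇔inj tt))

  minor : ∀ {m k} → Fin (suc m) → Mat F (suc m) (suc k) → Mat F m k
  minor i X r c = X (punchIn i r) (suc c)

  term-cons : ∀ {m k} (X : Mat F (suc m) (suc k)) (i : Fin (suc m)) (τ : Fin k → Fin m) →
              term X (i VF.∷ punchIn i ∘ τ) ≈ −1^ toℕ i * (X i zero * term (minor i X) τ)
  term-cons X i τ rewrite isInjective-cons i τ with isInjective F τ | T-isInjective τ
  ... | false | _      = sym (trans (*-congˡ (zeroʳ _)) (zeroʳ _))
  ... | true  | T⇔inj = begin
    sgnMK F (i VF.∷ punchIn i ∘ τ) * prodF F (λ α → X ((i VF.∷ punchIn i ∘ τ) α) α)
      ≈⟨ *-cong (sgnMK-cons i τ (to T⇔inj tt)) (reflexive (prodF-suc (λ α → X ((i VF.∷ punchIn i ∘ τ) α) α))) ⟩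
    (−1^ toℕ i * sgnMK F τ) * (X i zero * prodF F (λ α → minor i X (τ α) α))
      ≈⟨ interchange _ _ _ _ ⟩
    (−1^ toℕ i * X i zero) * (sgnMK F τ * prodF F (λ α → minor i X (τ α) α))
      ≈⟨ *-assoc _ _ _ ⟩
    −1^ toℕ i * (X i zero * (sgnMK F τ * prodF F (λ α → minor i X (τ α) α)))
      ∎

  laplace : ∀ {m k} (X : Mat F (suc m) (suc k)) →
            cullisDet F X ≈ ∑[ i < suc m ] (−1^ toℕ i * (X i zero * cullisDet F (minor i X)))
  laplace {m} {k} X = begin
    cullisDet F X
      ≈⟨ cullisDet≈sumMap-term X ⟩
    sumMap (term X) (allMaps F (suc k) (suc m))
      ≈⟨ sumMap-allMaps-suc (term X) ⟩
    ∑[ i < suc m ] sumMap (λ f → term X (i VF.∷ f)) (allMaps F k (suc m))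
      ≈⟨ sum-cong-≋ {suc m} expand-row ⟩
    ∑[ i < suc m ] (−1^ toℕ i * (X i zero * cullisDet F (minor i X)))
      ∎
    where
      expand-row : ∀ i → sumMap (λ f → term X (i VF.∷ f)) (allMaps F k (suc m)) ≈
                         −1^ toℕ i * (X i zero * cullisDet F (minor i X))
      expand-row i = begin
        sumMap (λ f → term X (i VF.∷ f)) (allMaps F k (suc m))
          ≈⟨ sumMap-allMaps-punchIn i _ (term-cong X ∘ ∷-cong ≡.refl)
               (λ f α fα≡i → term-≈0 X _ (λ inj → FinP.0≢1+n (inj (≡.sym fα≡i)))) ⟩
        sumMap (λ τ → term X (i VF.∷ punchIn i ∘ τ)) (allMaps F k m)
          ≈⟨ sumMap-cong (term-cons X i) (allMaps F k m) ⟩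
        sumMap (λ τ → −1^ toℕ i * (X i zero * term (minor i X) τ)) (allMaps F k m)
          ≈⟨ *-distribˡ-sumMap (−1^ toℕ i) _ (allMaps F k m) ⟩
        −1^ toℕ i * sumMap (λ τ → X i zero * term (minor i X) τ) (allMaps F k m)
          ≈⟨ *-congˡ (*-distribˡ-sumMap (X i zero) _ (allMaps F k m)) ⟩
        −1^ toℕ i * (X i zero * sumMap (term (minor i X)) (allMaps F k m))
          ≈⟨ *-congˡ (*-congˡ (cullisDet≈sumMap-term (minor i X))) ⟨
        −1^ toℕ i * (X i zero * cullisDet F (minor i X))
          ∎

  cullisDet-no-columns : ∀ {m} (X : Mat F m 0) → cullisDet F X ≈ 1#
  cullisDet-no-columns X = trans (+-identityʳ _) (trans (*-identityʳ _) (*-identityʳ _))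

  -- The first-column expansion of X with its first column replaced by ones.
  alternatingMinorSum : ∀ {m k} → Mat F (suc m) (suc k) → Carrier
  alternatingMinorSum {m} X = ∑[ i < suc m ] (−1^ toℕ i * cullisDet F (minor i X))

  alternatingMinorSum≈0 : ∀ {m k} (X : Mat F (suc m) (suc k)) → (suc m ℕ.+ suc k) % 2 ≡ 1 →
                          alternatingMinorSum X ≈ 0#
  alternatingMinorSum≈0 {m} {zero} X odd = begin
    ∑[ i < suc m ] (−1^ toℕ i * cullisDet F (minor i X))  ≈⟨ sum-cong-≋ {suc m} no-columns ⟩
    ∑[ i < suc m ] (−1^ toℕ i)                             ≈⟨ ∑-−1^≈0 (suc m) odd ⟩
    0#                                                     ∎
    where
      no-columns : ∀ i → −1^ toℕ i * cullisDet F (minor i X) ≈ −1^ toℕ i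
      no-columns i = trans (*-congˡ (cullisDet-no-columns (minor i X))) (*-identityʳ _)
  alternatingMinorSum≈0 {zero}  {suc k} X odd = trans (+-identityʳ _) (zeroʳ _)
  alternatingMinorSum≈0 {suc m} {suc k} X odd = begin
    ∑[ a < suc (suc m) ] (−1^ toℕ a * cullisDet F (minor a X))
      ≈⟨ sum-cong-≋ {suc (suc m)} expand ⟩
    ∑[ a < suc (suc m) ] ∑[ j < suc m ] t a j
      ≈⟨ ∑-punchIn-transpose t ⟩
    ∑[ b < suc (suc m) ] ∑[ i < suc m ] t (punchIn b i) (punchOut (FinP.punchInᵢ≢i b i))
      ≈⟨ sum-cong-≋ {suc (suc m)} (λ b → sum-cong-≋ {suc m} (t-transposed b)) ⟩
    ∑[ b < suc (suc m) ] ∑[ i < suc m ] (w b * (−1^ toℕ i * cullisDet F (minor i (minor b X))))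
      ≈⟨ sum-cong-≋ {suc (suc m)} (λ b → *-distribˡ-sum (w b) (λ i → −1^ toℕ i * cullisDet F (minor i (minor b X)))) ⟨
    ∑[ b < suc (suc m) ] (w b * alternatingMinorSum (minor b X))
      ≈⟨ ∑≈0 vanish ⟩
    0#
      ∎
    where
      open OffDiagonal +-commutativeMonoid using (∑-punchIn-transpose)
      minorTerm : Fin (suc (suc m)) → Fin (suc m) → Carrier
      minorTerm a j = −1^ toℕ j * (X (punchIn a j) (suc zero) * cullisDet F (minor j (minor a X)))
      t : Fin (suc (suc m)) → Fin (suc m) → Carrier
      t a j = −1^ toℕ a * minorTerm a j
      w : Fin (suc (suc m)) → Carrier
      w b = - (−1^ toℕ b * X b (suc zero))
      expand : ∀ a → −1^ toℕ a * cullisDet F (minor a X) ≈ ∑[ j < suc m ] t a j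
      expand a = trans (*-congˡ (laplace (minor a X))) (*-distribˡ-sum (−1^ toℕ a) (minorTerm a))
      vanish : ∀ b → w b * alternatingMinorSum (minor b X) ≈ 0#
      vanish b = trans (*-congˡ (alternatingMinorSum≈0 (minor b X) ([1+m]+[1+k]%2≡1⇒[m+k]%2≡1 (suc m) (suc k) odd))) (zeroʳ _)
      t-transposed : ∀ b i → t (punchIn b i) (punchOut (FinP.punchInᵢ≢i b i)) ≈
                             w b * (−1^ toℕ i * cullisDet F (minor i (minor b X)))
      t-transposed b i = begin
        −1^ toℕ a * (−1^ toℕ j * (X (punchIn a j) (suc zero) * cullisDet F (minor j (minor a X))))
          ≈⟨ *-assoc _ _ _ ⟨
        (−1^ toℕ a * −1^ toℕ j) * (X (punchIn a j) (suc zero) * cullisDet F (minor j (minor a X)))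
          ≈⟨ *-cong sign (*-cong (reflexive (≡.cong (λ r → X r (suc zero)) (FinP.punchIn-punchOut a≢b)))
                                 (cullisDet-cong (λ r c → reflexive (≡.cong (λ r → X r (suc (suc c)))
                                                                     (punchIn-punchIn-punchOut b i a≢b r))))) ⟩
        - (−1^ toℕ b * −1^ toℕ i) * (X b (suc zero) * cullisDet F (minor i (minor b X)))
          ≈⟨ -‿distribˡ-* _ _ ⟨
        - ((−1^ toℕ b * −1^ toℕ i) * (X b (suc zero) * cullisDet F (minor i (minor b X))))
          ≈⟨ -‿cong (interchange _ _ _ _) ⟩
        - ((−1^ toℕ b * X b (suc zero)) * (−1^ toℕ i * cullisDet F (minor i (minor b X))))
          ≈⟨ -‿distribˡ-* _ _ ⟩
        - (−1^ toℕ b * X b (suc zero)) * (−1^ toℕ i * cullisDet F (minor i (minor b X)))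
          ∎
        where
          a = punchIn b i
          a≢b = FinP.punchInᵢ≢i b i
          j = punchOut a≢b
          sign : −1^ toℕ a * −1^ toℕ j ≈ - (−1^ toℕ b * −1^ toℕ i)
          sign = begin
            −1^ toℕ a * −1^ toℕ j        ≈⟨ −1^-+ (toℕ a) (toℕ j) ⟨
            −1^ (toℕ a ℕ.+ toℕ j)        ≈⟨ −1^-adjacent (toℕ-punchIn+toℕ-punchOut b i a≢b) ⟩
            - −1^ (toℕ b ℕ.+ toℕ i)      ≈⟨ -‿cong (−1^-+ (toℕ b) (toℕ i)) ⟩
            - (−1^ toℕ b * −1^ toℕ i)    ∎

  addToEachRow : ∀ {m k} → (Fin k → Carrier) → Mat F m k → Mat F m k
  addToEachRow v X r c = X r c + v c

  cullisDet-addToEachRow : ∀ {m k} (v : Fin k → Carrier) (X : Mat F m k) → (m ℕ.+ k) % 2 ≡ 1 →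
                           cullisDet F (addToEachRow v X) ≈ cullisDet F X
  cullisDet-addToEachRow {m}     {zero}  v X _   = refl
  cullisDet-addToEachRow {zero}  {suc k} v X _   = refl
  cullisDet-addToEachRow {suc m} {suc k} v X odd = begin
    cullisDet F (addToEachRow v X)
      ≈⟨ laplace (addToEachRow v X) ⟩
    ∑[ i < suc m ] (−1^ toℕ i * ((X i zero + v zero) * cullisDet F (addToEachRow (VF.tail v) (minor i X))))
      ≈⟨ sum-cong-≋ {suc m} expand ⟩
    ∑[ i < suc m ] (−1^ toℕ i * (X i zero * d i) + v zero * (−1^ toℕ i * d i))
      ≈⟨ ∑-distrib-+ (λ i → −1^ toℕ i * (X i zero * d i)) (λ i → v zero * (−1^ toℕ i * d i)) ⟩
    ∑[ i < suc m ] (−1^ toℕ i * (X i zero * d i)) + ∑[ i < suc m ] (v zero * (−1^ toℕ i * d i))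
      ≈⟨ +-cong (laplace X) (*-distribˡ-sum (v zero) (λ i → −1^ toℕ i * d i)) ⟨
    cullisDet F X + v zero * alternatingMinorSum X
      ≈⟨ +-congˡ (trans (*-congˡ (alternatingMinorSum≈0 X odd)) (zeroʳ _)) ⟩
    cullisDet F X + 0#
      ≈⟨ +-identityʳ _ ⟩
    cullisDet F X
      ∎
    where
      d : Fin (suc m) → Carrier
      d i = cullisDet F (minor i X)
      expand : ∀ i → −1^ toℕ i * ((X i zero + v zero) * cullisDet F (addToEachRow (VF.tail v) (minor i X))) ≈
                     −1^ toℕ i * (X i zero * d i) + v zero * (−1^ toℕ i * d i)
      expand i = begin
        −1^ toℕ i * ((X i zero + v zero) * cullisDet F (addToEachRow (VF.tail v) (minor i X)))
          ≈⟨ *-congˡ (*-congˡ (cullisDet-addToEachRow (VF.tail v) (minor i X) ([1+m]+[1+k]%2≡1⇒[m+k]%2≡1 m k odd))) ⟩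
        −1^ toℕ i * ((X i zero + v zero) * d i)
          ≈⟨ *-congˡ (distribʳ _ _ _) ⟩
        −1^ toℕ i * (X i zero * d i + v zero * d i)
          ≈⟨ distribˡ _ _ _ ⟩
        −1^ toℕ i * (X i zero * d i) + −1^ toℕ i * (v zero * d i)
          ≈⟨ +-congˡ (x∙yz≈y∙xz _ _ _) ⟩
        −1^ toℕ i * (X i zero * d i) + v zero * (−1^ toℕ i * d i)
          ∎

  cullisDet-drop-zero-last-row : ∀ {n k} (Z : Mat F (suc n) k) → (∀ c → Z (fromℕ n) c ≈ 0#) →
                                 cullisDet F Z ≈ cullisDet F (VF.init Z)
  cullisDet-drop-zero-last-row {n}     {zero}  Z _      = refl
  cullisDet-drop-zero-last-row {zero}  {suc k} Z last≈0 =
    trans (laplace Z) (trans (+-identityʳ _) (trans (*-congˡ (trans (*-congʳ (last≈0 zero)) (zeroˡ _))) (zeroʳ _)))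
  cullisDet-drop-zero-last-row {suc n} {suc k} Z last≈0 = begin
    cullisDet F Z
      ≈⟨ laplace Z ⟩
    ∑[ i < suc (suc n) ] t i
      ≈⟨ sum-init-last t ⟩
    ∑[ i < suc n ] t (inject₁ i) + t (fromℕ (suc n))
      ≈⟨ +-cong (sum-cong-≋ {suc n} t-init) t-last ⟩
    ∑[ i < suc n ] (−1^ toℕ i * (VF.init Z i zero * cullisDet F (minor i (VF.init Z)))) + 0#
      ≈⟨ +-identityʳ _ ⟩
    ∑[ i < suc n ] (−1^ toℕ i * (VF.init Z i zero * cullisDet F (minor i (VF.init Z))))
      ≈⟨ laplace (VF.init Z) ⟨
    cullisDet F (VF.init Z)
      ∎
    where
      t : Fin (suc (suc n)) → Carrier
      t i = −1^ toℕ i * (Z i zero * cullisDet F (minor i Z))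
      t-last : t (fromℕ (suc n)) ≈ 0#
      t-last = trans (*-congˡ (trans (*-congʳ (last≈0 zero)) (zeroˡ _))) (zeroʳ _)
      t-init : ∀ i → t (inject₁ i) ≈ −1^ toℕ i * (VF.init Z i zero * cullisDet F (minor i (VF.init Z)))
      t-init i = *-cong (reflexive (≡.cong −1^_ (FinP.toℕ-inject₁ i))) (*-congˡ (begin
        cullisDet F (minor (inject₁ i) Z)
          ≈⟨ cullisDet-drop-zero-last-row (minor (inject₁ i) Z)
               (λ c → trans (reflexive (≡.cong (λ r → Z r (suc c)) (punchIn-inject₁-fromℕ i))) (last≈0 (suc c))) ⟩
        cullisDet F (VF.init (minor (inject₁ i) Z))
          ≈⟨ cullisDet-cong (λ r c → reflexive (≡.cong (λ r → Z r (suc c)) (punchIn-inject₁-inject₁ i r))) ⟩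
        cullisDet F (minor i (VF.init Z))
          ∎))

  cullisDet-L⁺ : ∀ {n k} (Y : Mat F n k) → cullisDet F (L⁺ F {suc n} Y) ≈ cullisDet F Y
  cullisDet-L⁺ {n} Y = begin
    cullisDet F (L⁺ F {suc n} Y)            ≈⟨ cullisDet-drop-zero-last-row (L⁺ F {suc n} Y) last-row ⟩
    cullisDet F (VF.init (L⁺ F {suc n} Y))  ≈⟨ cullisDet-cong init-rows ⟩
    cullisDet F Y                           ∎
    where
      last-row : ∀ c → L⁺ F {suc n} Y (fromℕ n) c ≈ 0#
      last-row c = reflexive (≡.cong (λ row → row c) (insertAt-lookup Y (fromℕ n) _))
      init-rows : ∀ r c → L⁺ F {suc n} Y (inject₁ r) c ≈ Y r c
      init-rows r c = reflexive (≡.cong (λ row → row c)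
        (≡.trans (≡.cong (VF.insertAt Y (fromℕ n) _) (≡.sym (punchIn-fromℕ r))) (insertAt-punchIn Y (fromℕ n) _ r)))

  cullisDet-L⁻ : ∀ {n k} (X : Mat F (suc n) k) → (suc n ℕ.+ k) % 2 ≡ 1 → cullisDet F (L⁻ F X) ≈ cullisDet F X
  cullisDet-L⁻ {n} X odd = begin
    cullisDet F (L⁻ F X)  ≈⟨ cullisDet-drop-zero-last-row W (λ c → -‿inverseʳ (X (fromℕ n) c)) ⟨
    cullisDet F W         ≈⟨ cullisDet-addToEachRow (λ c → - X (fromℕ n) c) X odd ⟩
    cullisDet F X         ∎
    where
      W = addToEachRow (λ c → - X (fromℕ n) c) X

open CullisDeterminant using (cullisDet-L⁺; cullisDet-L⁻)
open import Data.Nat.Base using (_+_)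
import Relation.Binary.Reasoning.Setoid as ≈-Reasoning

lemma4p7 : ∀ {c ℓ} (F : Field c ℓ) (n k : ℕ) →
    CardGreaterThan F k → 1 ≤ k → k < n → (n + k) % 2 ≡ 1 →
    (T : Mat F n k → Mat F n k) → IsLinear F T →
    (∀ X → Field._≈_ F (cullisDet F (T X)) (cullisDet F X)) →
    ∀ (Y : Mat F (n ∸ 1) k) →
    Field._≈_ F (cullisDet F ((L⁻ F ∘ T ∘ L⁺ F) Y)) (cullisDet F Y)
lemma4p7 F zero    k _ _ ()  _   _ _ _             _
lemma4p7 F (suc n) k _ _ _   odd T _ T-preserves-det Y = begin
  cullisDet F (L⁻ F (T (L⁺ F Y)))  ≈⟨ cullisDet-L⁻ F (T (L⁺ F Y)) odd ⟩
  cullisDet F (T (L⁺ F Y))         ≈⟨ T-preserves-det (L⁺ F Y) ⟩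
  cullisDet F (L⁺ F Y)             ≈⟨ cullisDet-L⁺ F Y ⟩
  cullisDet F Y                    ∎
  where open ≈-Reasoning (Field.setoid F)
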